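{- Let $x,y$ be distinct odd primes such that $y\equiv3\pmod4$ and $\left(\frac{x}{y}\right)=1$. Then $x$ is not balanced modulo $y$.
   Context: For coprime positive integers $n,m$, "$n$ is balanced modulo $m$" is the notion of Pomerance and Ulmer; it is characterized as follows (Pomerance–Ulmer, Theorem 2.1): $n$ is NOT balanced modulo $m$ if and only if there exists an odd Dirichlet character $\chi$ modulo $m$ (i.e. $\chi(-1)=-1$) with $\chi(n)=1$ and $\sum_{0<k<m/2}\chi(k)\neq0$. $\left(\frac{x}{y}\right)$ is the Legendre symbol. -}

module Defs where

open import Data.Bool using (Bool; _∧_)
open import Data.Nat using (ℕ; zero; suc; _+_; _*_; _^_; _<_; _≤_; NonZero)
open import Data.Nat.Properties using (_≟_; _<?_)
open import Data.Nat.DivMod using (_%_)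
open import Data.Nat.Divisibility using (_∣_)
open import Data.Nat.Coprimality using (Coprime)
open import Data.List using (List; upTo; filterᵇ; length)
open import Data.Bool.ListAction using (any)
open import Data.Product using (∃; _×_)
open import Relation.Nullary using (¬_)
open import Relation.Nullary.Decidable using (⌊_⌋)
open import Relation.Binary.PropositionalEquality using (_≡_)

-- b lies in the coset a·⟨n⟩ of (ℤ/mℤ)^*: b ≡ a·n^k (mod m) for some k.
-- Since ord(n) ≤ φ(m) < m, it suffices to let k range over 0 … m-1.
inCoset : (m n a b : ℕ) → .{{NonZero m}} → Bool
inCoset m n a b = any (λ k → ⌊ (a * n ^ k) % m ≟ b % m ⌋) (upTo m)

residues : ℕ → List ℕ
residues m = upTo m

lowerCount : (m n a : ℕ) → .{{NonZero m}} → ℕ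
lowerCount m n a =
  length (filterᵇ (λ b → inCoset m n a b ∧ ⌊ 0 <? b ⌋ ∧ ⌊ 2 * b <? m ⌋) (residues m))

upperCount : (m n a : ℕ) → .{{NonZero m}} → ℕ
upperCount m n a =
  length (filterᵇ (λ b → inCoset m n a b ∧ ⌊ m <? 2 * b ⌋) (residues m))

-- Pomerance–Ulmer: n (coprime to m) is balanced modulo m iff every coset of
-- the subgroup ⟨n⟩ in (ℤ/mℤ)^* has as many elements in (0,m/2) as in (m/2,m).
Balanced : (n m : ℕ) → .{{NonZero m}} → Set
Balanced n m = ∀ a → a < m → Coprime a m → lowerCount m n a ≡ upperCount m n a

LegendreOne : (x y : ℕ) → .{{NonZero y}} → Set
LegendreOne x y = ¬ (y ∣ x) × ∃ λ z → (z * z) % y ≡ x % y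

-- Let p = y = 3 + 4q and let H = ⟨x⟩ be the subgroup of (ℤ/p)ˣ generated by x.
-- If x were balanced, the coset H itself would have as many elements in
-- (0, p/2) as in (p/2, p); as p is odd and 0 ∉ H, this makes |H| even.
-- But inversion b ↦ b ^ (p - 2) is an involution of H, and its fixed points
-- satisfy b² ≡ 1, so b ≡ ±1.  Since x is a square, so is every element of H,
-- whereas -1 is not a square for p ≡ 3 (mod 4): c ^ (p - 1) = (c²) ^ ((p - 1)/2)
-- would be (-1) ^ odd.  Hence 1 is the only fixed point and |H| is odd.
module Submission where

open import Defs
open import Data.Bool using (Bool; true; false; T; _∧_)
open import Data.Bool.Properties using (T-≡)
open import Data.Empty using (⊥-elim)
open import Data.Fin.Base using (Fin; zero; suc; toℕ; inject₁; fromℕ; fromℕ<)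
import Data.Fin.Properties as Fin
open import Data.Fin.Permutation using (permutation)
open import Data.List using (filterᵇ; length; applyUpTo; upTo)
open import Data.List.Relation.Unary.Any.Properties using (any⁺; any⁻; applyUpTo⁺; applyUpTo⁻)
open import Data.Nat
open import Data.Nat.Properties hiding (_≟_; _<?_)
open import Algebra.Properties.CommutativeMonoid.Sum +-0-commutativeMonoid
  using (sum-syntax; sum-cong-≗; ∑-distrib-+; sum-permute; sum-replicate-zero; sum-init-last)
import Algebra.Properties.CommutativeSemiring.Binomial +-*-commutativeSemiring as Binomial
open import Algebra.Properties.Monoid.Mult +-0-monoid using (_×_)
open import Algebra.Properties.Semiring.Exp +-*-semiring using () renaming (_^_ to _^ˢ_)
open import Data.Nat.Combinatorics using (_C_; nCn≡1; k![n∸k]!∣n!)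
open import Data.Nat.Combinatorics.Specification using (nCk≡n!/k![n-k]!)
open import Data.Nat.Coprimality using (1-coprimeTo)
open import Data.Nat.Divisibility
open import Data.Nat.DivMod
open import Data.Nat.Primality using (Prime; prime⇒nonZero; prime⇒nonTrivial; euclidsLemma)
open import Data.Nat.Tactic.RingSolver using (solve-∀)
open import Data.Product using (∃; _,_)
open import Data.Sum using (_⊎_; inj₁; inj₂; [_,_]′)
open import Function using (_∘_; id)
open import Function.Bundles using (Equivalence)
open import Relation.Binary.Definitions using (tri<; tri≈; tri>)
open import Relation.Binary.PropositionalEquality
open import Relation.Nullary using (¬_; yes; no)
open import Relation.Nullary.Decidable using (does; ⌊_⌋; dec-true; dec-false; toWitness; fromWitness)

T-injective : ∀ {a b} → (T a → T b) → (T b → T a) → a ≡ b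
T-injective {false} {false} _   _   = refl
T-injective {false} {true}  _   b⇒a = ⊥-elim (b⇒a _)
T-injective {true}  {false} a⇒b _   = ⊥-elim (a⇒b _)
T-injective {true}  {true}  _   _   = refl

indicator : Bool → ℕ
indicator true  = 1
indicator false = 0

count : ∀ {n} → (Fin n → Bool) → ℕ
count {n} P = ∑[ i < n ] indicator (P i)

length-filterᵇ-applyUpTo : ∀ (P : ℕ → Bool) f n →
                           length (filterᵇ P (applyUpTo f n)) ≡ count {n} (P ∘ f ∘ toℕ)
length-filterᵇ-applyUpTo P f zero    = refl
length-filterᵇ-applyUpTo P f (suc n) with P (f 0)
... | true  = cong suc (length-filterᵇ-applyUpTo P (f ∘ suc) n)
... | false = length-filterᵇ-applyUpTo P (f ∘ suc) n

count-split : ∀ {n} (P Q R : Fin n → Bool) →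
              (∀ i → indicator (P i) ≡ indicator (Q i) + indicator (R i)) →
              count P ≡ count Q + count R
count-split P Q R split = trans (sum-cong-≗ split) (∑-distrib-+ (indicator ∘ Q) (indicator ∘ R))

count-≟ : ∀ {n} (j : Fin n) → count (λ i → does (i Fin.≟ j)) ≡ 1
count-≟ {suc n} zero    = cong suc (sum-replicate-zero n)
count-≟ {suc n} (suc j) = count-≟ {n} j

module _ {n} (π : Fin n → Fin n) (π-involutive : ∀ i → π (π i) ≡ i) where

  count-permute : (P : Fin n → Bool) → count (P ∘ π) ≡ count P
  count-permute P = sym (sum-permute (indicator ∘ P) (permutation π π π-involutive π-involutive))

  count-involution : (P : Fin n → Bool) → (∀ i → P (π i) ≡ P i) →
                     count P ≡ count (λ i → P i ∧ does (π i Fin.≟ i))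
                               + 2 * count (λ i → P i ∧ does (i Fin.<? π i))
  count-involution P P∘π≗P = begin
    count P
      ≡⟨ sum-cong-≗ trichotomy ⟩
    ∑[ i < n ] (ι Fixed i + ι Up i + ι Down i)
      ≡⟨ ∑-distrib-+ (λ i → ι Fixed i + ι Up i) (ι Down) ⟩
    ∑[ i < n ] (ι Fixed i + ι Up i) + count Down
      ≡⟨ cong₂ _+_ (∑-distrib-+ (ι Fixed) (ι Up)) count-Down≡count-Up ⟩
    count Fixed + count Up + count Up
      ≡⟨ +-assoc (count Fixed) (count Up) (count Up) ⟩
    count Fixed + (count Up + count Up)
      ≡⟨ cong (λ c → count Fixed + (count Up + c)) (+-identityʳ (count Up)) ⟨
    count Fixed + 2 * count Up
      ∎
    where
    open ≡-Reasoning
    Fixed Up Down : Fin n → Bool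
    Fixed i = P i ∧ does (π i Fin.≟ i)
    Up    i = P i ∧ does (i Fin.<? π i)
    Down  i = P i ∧ does (π i Fin.<? i)

    ι : (Fin n → Bool) → Fin n → ℕ
    ι Q i = indicator (Q i)

    trichotomy : ∀ i → indicator (P i) ≡ ι Fixed i + ι Up i + ι Down i
    trichotomy i with P i
    ... | false = refl
    ... | true with Fin.<-cmp i (π i)
    ...   | tri< i<πi i≢πi πi≮i rewrite dec-false (π i Fin.≟ i) (i≢πi ∘ sym)
                                      | dec-true (i Fin.<? π i) i<πi | dec-false (π i Fin.<? i) πi≮i = refl
    ...   | tri≈ i≮πi i≡πi πi≮i rewrite dec-true (π i Fin.≟ i) (sym i≡πi)
                                      | dec-false (i Fin.<? π i) i≮πi | dec-false (π i Fin.<? i) πi≮i = refl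
    ...   | tri> i≮πi i≢πi πi<i rewrite dec-false (π i Fin.≟ i) (i≢πi ∘ sym)
                                      | dec-false (i Fin.<? π i) i≮πi | dec-true (π i Fin.<? i) πi<i = refl

    count-Down≡count-Up : count Down ≡ count Up
    count-Down≡count-Up = trans (sum-cong-≗ Down≗Up∘π) (count-permute Up)
      where
      Down≗Up∘π : ∀ i → ι Down i ≡ ι Up (π i)
      Down≗Up∘π i rewrite P∘π≗P i | π-involutive i = refl

  count-involution-unique-fixed-point :
    (P : Fin n → Bool) → (∀ i → P (π i) ≡ P i) →
    (j : Fin n) → (∀ i → (P i ∧ does (π i Fin.≟ i)) ≡ does (i Fin.≟ j)) →
    count P ≡ 1 + 2 * count (λ i → P i ∧ does (i Fin.<? π i))
  count-involution-unique-fixed-point P P∘π≗P j fixed≗j =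
    trans (count-involution P P∘π≗P) (cong (_+ 2 * count (λ i → P i ∧ does (i Fin.<? π i))) count-Fixed≡1)
    where
    count-Fixed≡1 : count (λ i → P i ∧ does (π i Fin.≟ i)) ≡ 1
    count-Fixed≡1 = trans (sum-cong-≗ (cong indicator ∘ fixed≗j)) (count-≟ j)

^ˢ≡^ : ∀ a n → a ^ˢ n ≡ a ^ n
^ˢ≡^ a zero    = refl
^ˢ≡^ a (suc n) = cong (a *_) (^ˢ≡^ a n)

×≡* : ∀ n a → n × a ≡ n * a
×≡* zero    a = refl
×≡* (suc n) a = cong (a +_) (×≡* n a)

binomialTerm[a,1] : ∀ a n k → Binomial.binomialTerm a 1 n k ≡ (n C toℕ k) * a ^ toℕ k
binomialTerm[a,1] a n k = begin
  (n C toℕ k) × (a ^ˢ toℕ k * 1 ^ˢ (n ∸ toℕ k)) ≡⟨ ×≡* (n C toℕ k) _ ⟩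
  (n C toℕ k) * (a ^ˢ toℕ k * 1 ^ˢ (n ∸ toℕ k)) ≡⟨ cong₂ (λ u v → (n C toℕ k) * (u * v)) (^ˢ≡^ a (toℕ k)) 1^ˢ≡1 ⟩
  (n C toℕ k) * (a ^ toℕ k * 1)                 ≡⟨ cong ((n C toℕ k) *_) (*-identityʳ (a ^ toℕ k)) ⟩
  (n C toℕ k) * a ^ toℕ k                       ∎
  where
  open ≡-Reasoning
  1^ˢ≡1 : 1 ^ˢ (n ∸ toℕ k) ≡ 1
  1^ˢ≡1 = trans (^ˢ≡^ 1 (n ∸ toℕ k)) (^-zeroˡ (n ∸ toℕ k))

binomial-inner-terms : ∀ a n .{{_ : NonZero n}} →
  (a + 1) ^ n ≡ 1 + ∑[ k < pred n ] ((n C suc (toℕ k)) * a ^ suc (toℕ k)) + a ^ n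
binomial-inner-terms a n@(suc n-1) = begin
  (a + 1) ^ n
    ≡⟨ ^ˢ≡^ (a + 1) n ⟨
  (a + 1) ^ˢ n
    ≡⟨ Binomial.theorem n a 1 ⟩
  term zero + ∑[ k < n ] term (suc k)
    ≡⟨ cong (term zero +_) (sum-init-last (term ∘ suc)) ⟩
  term zero + (∑[ k < n-1 ] term (suc (inject₁ k)) + term (suc (fromℕ n-1)))
    ≡⟨ cong₂ _+_ first (cong₂ _+_ (sum-cong-≗ inner) last) ⟩
  1 + (∑[ k < n-1 ] ((n C suc (toℕ k)) * a ^ suc (toℕ k)) + a ^ n)
    ≡⟨ +-assoc 1 _ (a ^ n) ⟨
  1 + ∑[ k < n-1 ] ((n C suc (toℕ k)) * a ^ suc (toℕ k)) + a ^ n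
    ∎
  where
  open ≡-Reasoning
  term : Fin (suc n) → ℕ
  term = Binomial.binomialTerm a 1 n

  first : term zero ≡ 1
  first = binomialTerm[a,1] a n zero

  inner : ∀ k → term (suc (inject₁ k)) ≡ (n C suc (toℕ k)) * a ^ suc (toℕ k)
  inner k = trans (binomialTerm[a,1] a n (suc (inject₁ k)))
                  (cong (λ j → (n C suc j) * a ^ suc j) (Fin.toℕ-inject₁ k))

  last : term (suc (fromℕ n-1)) ≡ a ^ n
  last = begin
    term (suc (fromℕ n-1))
      ≡⟨ binomialTerm[a,1] a n (suc (fromℕ n-1)) ⟩
    (n C suc (toℕ (fromℕ n-1))) * a ^ suc (toℕ (fromℕ n-1))
      ≡⟨ cong (λ j → (n C suc j) * a ^ suc j) (Fin.toℕ-fromℕ n-1) ⟩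
    (n C n) * a ^ n
      ≡⟨ cong (_* a ^ n) (nCn≡1 n) ⟩
    1 * a ^ n
      ≡⟨ *-identityˡ (a ^ n) ⟩
    a ^ n
      ∎

∣-sum : ∀ {d n} (f : Fin n → ℕ) → (∀ i → d ∣ f i) → d ∣ ∑[ i < n ] f i
∣-sum {d} {zero}  f d∣f = d ∣0
∣-sum {d} {suc n} f d∣f = ∣m∣n⇒∣m+n (d∣f zero) (∣-sum (f ∘ suc) (d∣f ∘ suc))

∣∧<⇒≡0 : ∀ {m n} → m ∣ n → n < m → n ≡ 0
∣∧<⇒≡0 {n = zero}  _   _   = refl
∣∧<⇒≡0 {n = suc n} m∣n n<m = ⊥-elim (>⇒∤ n<m m∣n)

n∣n! : ∀ n .{{_ : NonZero n}} → n ∣ n !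
n∣n! (suc n) = m∣m*n (n !)

nCk*k![n∸k]!≡n! : ∀ {n k} → k ≤ n → (n C k) * (k ! * (n ∸ k) !) ≡ n !
nCk*k![n∸k]!≡n! {n} {k} k≤n = trans (cong (_* (k ! * (n ∸ k) !)) (nCk≡n!/k![n-k]! k≤n))
                                   (m/n*n≡m {{k !* (n ∸ k) !≢0}} (k![n∸k]!∣n! k≤n))

module Congruence (m : ℕ) .{{_ : NonZero m}} where

  infix 4 _≈_
  _≈_ : ℕ → ℕ → Set
  a ≈ b = a % m ≡ b % m

  %-≈ : ∀ a → a % m ≈ a
  %-≈ a = m%n%n≡m%n a m

  ≈⇒≡ : ∀ {a b} → a < m → b < m → a ≈ b → a ≡ b
  ≈⇒≡ a<m b<m a≈b = trans (sym (m<n⇒m%n≡m a<m)) (trans a≈b (m<n⇒m%n≡m b<m))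

  +-cong : ∀ {a b c d} → a ≈ b → c ≈ d → a + c ≈ b + d
  +-cong {a} {b} {c} {d} a≈b c≈d = begin
    (a + c) % m           ≡⟨ %-distribˡ-+ a c m ⟩
    (a % m + c % m) % m   ≡⟨ cong₂ (λ u v → (u + v) % m) a≈b c≈d ⟩
    (b % m + d % m) % m   ≡⟨ %-distribˡ-+ b d m ⟨
    (b + d) % m           ∎
    where open ≡-Reasoning

  *-cong : ∀ {a b c d} → a ≈ b → c ≈ d → a * c ≈ b * d
  *-cong {a} {b} {c} {d} a≈b c≈d = begin
    (a * c) % m           ≡⟨ %-distribˡ-* a c m ⟩
    (a % m * (c % m)) % m ≡⟨ cong₂ (λ u v → (u * v) % m) a≈b c≈d ⟩
    (b % m * (d % m)) % m ≡⟨ %-distribˡ-* b d m ⟨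
    (b * d) % m           ∎
    where open ≡-Reasoning

  ^-cong : ∀ {a b} → a ≈ b → ∀ k → a ^ k ≈ b ^ k
  ^-cong a≈b zero    = refl
  ^-cong a≈b (suc k) = *-cong a≈b (^-cong a≈b k)

  ≈⇒∣∸ : ∀ {a b} → a ≈ b → m ∣ b ∸ a
  ≈⇒∣∸ {a} {b} a≈b = divides (b / m ∸ a / m) (begin
    b ∸ a                                     ≡⟨ cong₂ _∸_ (m≡m%n+[m/n]*n b m) (m≡m%n+[m/n]*n a m) ⟩
    (b % m + b / m * m) ∸ (a % m + a / m * m) ≡⟨ cong (λ r → (b % m + b / m * m) ∸ (r + a / m * m)) a≈b ⟩
    (b % m + b / m * m) ∸ (b % m + a / m * m) ≡⟨ [m+n]∸[m+o]≡n∸o (b % m) _ _ ⟩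
    b / m * m ∸ a / m * m                     ≡⟨ *-distribʳ-∸ m (b / m) (a / m) ⟨
    (b / m ∸ a / m) * m                       ∎)
    where open ≡-Reasoning

  ∣∸⇒≈ : ∀ {a b} → a ≤ b → m ∣ b ∸ a → a ≈ b
  ∣∸⇒≈ {a} {b} a≤b (divides k b∸a≡k*m) = sym (begin
    b % m             ≡⟨ cong (_% m) (m+[n∸m]≡n a≤b) ⟨
    (a + (b ∸ a)) % m ≡⟨ cong (λ r → (a + r) % m) b∸a≡k*m ⟩
    (a + k * m) % m   ≡⟨ [m+kn]%n≡m%n a k m ⟩
    a % m             ∎)
    where open ≡-Reasoning

  ^-odd : ∀ {a} → a * a ≈ 1 → ∀ k → a ^ (1 + 2 * k) ≈ a
  ^-odd {a} a²≈1 zero    = cong (_% m) (*-identityʳ a)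
  ^-odd {a} a²≈1 (suc k) = begin
    a ^ (1 + 2 * suc k) % m       ≡⟨ cong (_% m) a^[3+2k]≡a²*a^[1+2k] ⟩
    (a * a) * a ^ (1 + 2 * k) % m ≡⟨ *-cong a²≈1 (^-odd a²≈1 k) ⟩
    1 * a % m                     ≡⟨ cong (_% m) (*-identityˡ a) ⟩
    a % m                         ∎
    where
    open ≡-Reasoning
    a^[3+2k]≡a²*a^[1+2k] : a ^ (1 + 2 * suc k) ≡ (a * a) * a ^ (1 + 2 * k)
    a^[3+2k]≡a²*a^[1+2k] = trans (cong (λ e → a ^ suc e) (*-suc 2 k)) (sym (*-assoc a a (a ^ (1 + 2 * k))))

module PrimeModulus (p : ℕ) (p-prime : Prime p) where

  instance
    p≢0 : NonZero p
    p≢0 = prime⇒nonZero p-prime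

  open Congruence p public

  1<p : 1 < p
  1<p = nonTrivial⇒n>1 p {{prime⇒nonTrivial p-prime}}

  p∣^⇒p∣ : ∀ {a} k → p ∣ a ^ k → p ∣ a
  p∣^⇒p∣     zero    p∣1   = ⊥-elim (>⇒∤ 1<p p∣1)
  p∣^⇒p∣ {a} (suc k) p∣a^k with euclidsLemma a (a ^ k) p-prime p∣a^k
  ... | inj₁ p∣a   = p∣a
  ... | inj₂ p∣a^k = p∣^⇒p∣ k p∣a^k

  p∤! : ∀ {n} → n < p → ¬ p ∣ n !
  p∤! {zero}  _   = >⇒∤ 1<p
  p∤! {suc n} n<p p∣n! with euclidsLemma (suc n) (n !) p-prime p∣n!
  ... | inj₁ p∣n  = >⇒∤ n<p p∣n
  ... | inj₂ p∣n! = p∤! (<-trans (n<1+n n) n<p) p∣n!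

  p∣pCk : ∀ {k} → 0 < k → k < p → p ∣ p C k
  p∣pCk {k} 0<k k<p
    with euclidsLemma (p C k) (k ! * (p ∸ k) !) p-prime
                      (subst (p ∣_) (sym (nCk*k![n∸k]!≡n! (<⇒≤ k<p))) (n∣n! p))
  ... | inj₁ p∣pCk = p∣pCk
  ... | inj₂ p∣k!*[p∸k]! with euclidsLemma (k !) ((p ∸ k) !) p-prime p∣k!*[p∸k]!
  ...   | inj₁ p∣k!     = ⊥-elim (p∤! k<p p∣k!)
  ...   | inj₂ p∣[p∸k]! = ⊥-elim (p∤! (∸-monoʳ-< 0<k (<⇒≤ k<p)) p∣[p∸k]!)

  freshman's-dream : ∀ a → (a + 1) ^ p ≈ a ^ p + 1
  freshman's-dream a = begin
    (a + 1) ^ p % p           ≡⟨ cong (_% p) (binomial-inner-terms a p) ⟩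
    (1 + inner + a ^ p) % p   ≡⟨ cong (_% p) (rearrange 1 inner (a ^ p)) ⟩
    (inner + (a ^ p + 1)) % p ≡⟨ %-remove-+ˡ (a ^ p + 1) (∣-sum _ p∣term) ⟩
    (a ^ p + 1) % p           ∎
    where
    open ≡-Reasoning
    inner : ℕ
    inner = ∑[ k < pred p ] ((p C suc (toℕ k)) * a ^ suc (toℕ k))

    p∣term : ∀ (k : Fin (pred p)) → p ∣ (p C suc (toℕ k)) * a ^ suc (toℕ k)
    p∣term k = ∣m⇒∣m*n (a ^ suc (toℕ k)) (p∣pCk z<s 1+k<p)
      where
      1+k<p : suc (toℕ k) < p
      1+k<p = subst (suc (toℕ k) <_) (suc-pred p) (s≤s (Fin.toℕ<n k))

    rearrange : ∀ u v w → u + v + w ≡ v + (w + u)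
    rearrange u v w = trans (cong (_+ w) (+-comm u v)) (trans (+-assoc v u w) (cong (v +_) (+-comm u w)))

  fermat : ∀ a → a ^ p ≈ a
  fermat zero    = cong (λ e → 0 ^ e % p) (sym (suc-pred p))
  fermat (suc a) = begin
    suc a ^ p % p   ≡⟨ cong (λ b → b ^ p % p) (+-comm 1 a) ⟩
    (a + 1) ^ p % p ≡⟨ freshman's-dream a ⟩
    (a ^ p + 1) % p ≡⟨ +-cong (fermat a) refl ⟩
    (a + 1) % p     ≡⟨ cong (_% p) (+-comm a 1) ⟩
    suc a % p       ∎
    where open ≡-Reasoning

  p∤a⇒p∣c∸b : ∀ {a b c} → ¬ p ∣ a → a * b ≈ a * c → p ∣ c ∸ b
  p∤a⇒p∣c∸b {a} {b} {c} p∤a ab≈ac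
    with euclidsLemma a (c ∸ b) p-prime (subst (p ∣_) (sym (*-distribˡ-∸ a c b)) (≈⇒∣∸ ab≈ac))
  ... | inj₁ p∣a   = ⊥-elim (p∤a p∣a)
  ... | inj₂ p∣c∸b = p∣c∸b

  *-cancelˡ : ∀ {a b c} → ¬ p ∣ a → a * b ≈ a * c → b ≈ c
  *-cancelˡ {a} {b} {c} p∤a ab≈ac with ≤-total b c
  ... | inj₁ b≤c = ∣∸⇒≈ b≤c (p∤a⇒p∣c∸b p∤a ab≈ac)
  ... | inj₂ c≤b = sym (∣∸⇒≈ c≤b (p∤a⇒p∣c∸b p∤a (sym ab≈ac)))

  fermat-little : ∀ {a} → ¬ p ∣ a → a ^ pred p ≈ 1
  fermat-little {a} p∤a = *-cancelˡ p∤a (begin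
    a * a ^ pred p % p ≡⟨ cong (λ e → a ^ e % p) (suc-pred p) ⟩
    a ^ p % p          ≡⟨ fermat a ⟩
    a % p              ≡⟨ cong (_% p) (*-identityʳ a) ⟨
    a * 1 % p          ∎)
    where open ≡-Reasoning

  square≈1 : ∀ {b} → b < p → b * b ≈ 1 → b ≡ 1 ⊎ suc b ≡ p
  square≈1 {zero}  0<p 0≈1 = ⊥-elim (0≢1+n (≈⇒≡ 0<p 1<p 0≈1))
  square≈1 {suc c} b<p b²≈1
    with euclidsLemma c (2 + c) p-prime (subst (p ∣_) (cong (_∸ 1) (b²≡1+c*[2+c] c)) (≈⇒∣∸ (sym b²≈1)))
    where
    b²≡1+c*[2+c] : ∀ c → (1 + c) * (1 + c) ≡ 1 + c * (2 + c)
    b²≡1+c*[2+c] = solve-∀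
  ... | inj₁ p∣c   = inj₁ (cong suc (∣∧<⇒≡0 p∣c (<-trans (n<1+n c) b<p)))
  ... | inj₂ p∣2+c = inj₂ (≤-antisym b<p (∣⇒≤ p∣2+c))

module _ (m n a : ℕ) .{{_ : NonZero m}} where

  inCoset-intro : ∀ b k → k < m → (a * n ^ k) % m ≡ b % m → T (inCoset m n a b)
  inCoset-intro b k k<m eq = any⁺ _ (applyUpTo⁺ id (fromWitness eq) k<m)

  inCoset-elim : ∀ b → T (inCoset m n a b) → ∃ λ k → (a * n ^ k) % m ≡ b % m
  inCoset-elim b b∈aN with k , _ , eq ← applyUpTo⁻ id (any⁻ _ (upTo m) b∈aN) = k , toWitness eq

  lowerCount+upperCount : (∀ b → 2 * b ≢ m) → ¬ T (inCoset m n a 0) →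
                          lowerCount m n a + upperCount m n a ≡ count {m} (λ i → inCoset m n a (toℕ i))
  lowerCount+upperCount 2b≢m 0∉aN = begin
    lowerCount m n a + upperCount m n a
      ≡⟨ cong₂ _+_ (length-filterᵇ-applyUpTo Lower id m) (length-filterᵇ-applyUpTo Upper id m) ⟩
    count {m} (Lower ∘ toℕ) + count {m} (Upper ∘ toℕ)
      ≡⟨ count-split {m} (Coset ∘ toℕ) (Lower ∘ toℕ) (Upper ∘ toℕ) (halves ∘ toℕ) ⟨
    count {m} (Coset ∘ toℕ) ∎
    where
    open ≡-Reasoning
    Coset Lower Upper : ℕ → Bool
    Coset b = inCoset m n a b
    Lower b = Coset b ∧ ⌊ 0 <? b ⌋ ∧ ⌊ 2 * b <? m ⌋
    Upper b = Coset b ∧ ⌊ m <? 2 * b ⌋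

    0<b : ∀ {b} → Coset b ≡ true → 0 < b
    0<b {zero}  0∈aN = ⊥-elim (0∉aN (Equivalence.from T-≡ 0∈aN))
    0<b {suc _} _    = z<s

    halves : ∀ b → indicator (Coset b) ≡ indicator (Lower b) + indicator (Upper b)
    halves b with Coset b in b∈aN
    ... | false = refl
    ... | true with 0 <? b | 2 * b <? m | m <? 2 * b
    ...   | no 0≮b | _        | _        = ⊥-elim (0≮b (0<b b∈aN))
    ...   | yes _  | yes 2b<m | yes m<2b = ⊥-elim (<-asym 2b<m m<2b)
    ...   | yes _  | yes _    | no _     = refl
    ...   | yes _  | no _     | yes _    = refl
    ...   | yes _  | no 2b≮m  | no m≮2b  = ⊥-elim (2b≢m b (≤-antisym (≮⇒≥ m≮2b) (≮⇒≥ 2b≮m)))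

module ThreeModFour (q : ℕ) (p-prime : Prime (3 + 4 * q)) where

  p : ℕ
  p = 3 + 4 * q

  open PrimeModulus p p-prime hiding (p≢0)

  p-1 : ℕ
  p-1 = 2 + 4 * q

  [p-1]²≈1 : p-1 * p-1 ≈ 1
  [p-1]²≈1 = trans (cong (_% p) ([p-1]²≡1+[p-2]*p q)) ([m+kn]%n≡m%n 1 (1 + 4 * q) p)
    where
    [p-1]²≡1+[p-2]*p : ∀ q → (2 + 4 * q) * (2 + 4 * q) ≡ 1 + (1 + 4 * q) * (3 + 4 * q)
    [p-1]²≡1+[p-2]*p = solve-∀

  p-1-nonresidue : ∀ c → ¬ c * c ≈ p-1
  p-1-nonresidue c c²≈p-1 = 1≢p-1 (≈⇒≡ 1<p (n<1+n p-1) (begin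
    1 % p                     ≡⟨ fermat-little p∤c ⟨
    c ^ p-1 % p               ≡⟨ cong (λ k → c ^ k % p) (p-1≡2*[1+2q] q) ⟩
    c ^ (2 * (1 + 2 * q)) % p ≡⟨ cong (_% p) (^-*-assoc c 2 (1 + 2 * q)) ⟨
    (c ^ 2) ^ (1 + 2 * q) % p ≡⟨ ^-cong {c ^ 2} {p-1} c^2≈p-1 (1 + 2 * q) ⟩
    p-1 ^ (1 + 2 * q) % p     ≡⟨ ^-odd {p-1} [p-1]²≈1 q ⟩
    p-1 % p                   ∎))
    where
    open ≡-Reasoning
    1≢p-1 : 1 ≢ p-1
    1≢p-1 ()

    c^2≈p-1 : c ^ 2 ≈ p-1
    c^2≈p-1 = trans (cong (λ d → c * d % p) (*-identityʳ c)) c²≈p-1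

    p-1≡2*[1+2q] : ∀ q → 2 + 4 * q ≡ 2 * (1 + 2 * q)
    p-1≡2*[1+2q] = solve-∀

    p∤c : ¬ p ∣ c
    p∤c p∣c = 0≢1+n (begin
      0           ≡⟨ n∣m⇒m%n≡0 (c * c) p (∣m⇒∣m*n c p∣c) ⟨
      c * c % p   ≡⟨ c²≈p-1 ⟩
      p-1 % p     ≡⟨ m<n⇒m%n≡m (n<1+n p-1) ⟩
      p-1         ∎)

  ^-reduce-exponent : ∀ {a} → ¬ p ∣ a → ∀ k → a ^ k ≈ a ^ (k % p-1)
  ^-reduce-exponent {a} p∤a k = begin
    a ^ k % p                         ≡⟨ cong (λ e → a ^ e % p) k≡r+p-1*[k/p-1] ⟩
    a ^ (r + p-1 * (k / p-1)) % p     ≡⟨ cong (_% p) (^-distribˡ-+-* a r (p-1 * (k / p-1))) ⟩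
    a ^ r * a ^ (p-1 * (k / p-1)) % p ≡⟨ cong (λ e → a ^ r * e % p) (^-*-assoc a p-1 (k / p-1)) ⟨
    a ^ r * (a ^ p-1) ^ (k / p-1) % p ≡⟨ *-cong {a ^ r} {a ^ r} {(a ^ p-1) ^ (k / p-1)} {1 ^ (k / p-1)}
                                                refl (^-cong {a ^ p-1} {1} (fermat-little p∤a) (k / p-1)) ⟩
    a ^ r * 1 ^ (k / p-1) % p         ≡⟨ cong (λ e → a ^ r * e % p) (^-zeroˡ (k / p-1)) ⟩
    a ^ r * 1 % p                     ≡⟨ cong (_% p) (*-identityʳ (a ^ r)) ⟩
    a ^ r % p                         ∎
    where
    open ≡-Reasoning
    r : ℕ
    r = k % p-1

    k≡r+p-1*[k/p-1] : k ≡ r + p-1 * (k / p-1)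
    k≡r+p-1*[k/p-1] = trans (m≡m%n+[m/n]*n k p-1) (cong (r +_) (*-comm (k / p-1) p-1))

  -- b ^ (p - 2), the inverse of b by Fermat's little theorem
  inv : ℕ → ℕ
  inv b = b ^ (1 + 4 * q) % p

  inv<p : ∀ b → inv b < p
  inv<p b = m%n<n (b ^ (1 + 4 * q)) p

  inv-involutive : ∀ {b} → b < p → inv (inv b) ≡ b
  inv-involutive {zero}      _   = refl
  inv-involutive {b@(suc _)} b<p = ≈⇒≡ (inv<p (inv b)) b<p (begin
    inv (inv b) % p             ≡⟨ %-≈ (inv b ^ e) ⟩
    inv b ^ e % p               ≡⟨ ^-cong {inv b} {b ^ e} (%-≈ (b ^ e)) e ⟩
    (b ^ e) ^ e % p             ≡⟨ cong (_% p) (^-*-assoc b e e) ⟩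
    b ^ (e * e) % p             ≡⟨ cong (λ k → b ^ k % p) (e²≡1+[p-1]*4q q) ⟩
    b * b ^ (p-1 * (4 * q)) % p ≡⟨ cong (λ k → b * k % p) (^-*-assoc b p-1 (4 * q)) ⟨
    b * (b ^ p-1) ^ (4 * q) % p ≡⟨ *-cong {b} {b} {(b ^ p-1) ^ (4 * q)} {1 ^ (4 * q)}
                                          refl (^-cong {b ^ p-1} {1} (fermat-little (>⇒∤ b<p)) (4 * q)) ⟩
    b * 1 ^ (4 * q) % p         ≡⟨ cong (λ k → b * k % p) (^-zeroˡ (4 * q)) ⟩
    b * 1 % p                   ≡⟨ cong (_% p) (*-identityʳ b) ⟩
    b % p                       ∎)
    where
    open ≡-Reasoning
    e : ℕ
    e = 1 + 4 * q

    e²≡1+[p-1]*4q : ∀ q → (1 + 4 * q) * (1 + 4 * q) ≡ 1 + (2 + 4 * q) * (4 * q)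
    e²≡1+[p-1]*4q = solve-∀

  inv-fixed-point : ∀ {b} → 0 < b → b < p → inv b ≡ b → b ≡ 1 ⊎ b ≡ p-1
  inv-fixed-point {b} 0<b b<p inv[b]≡b with square≈1 b<p b²≈1
    where
    b²≈1 : b * b ≈ 1
    b²≈1 = begin
      b * b % p                 ≡⟨ cong (λ c → b * c % p) inv[b]≡b ⟨
      b * inv b % p             ≡⟨ *-cong {b} {b} {inv b} refl (%-≈ (b ^ (1 + 4 * q))) ⟩
      b * b ^ (1 + 4 * q) % p   ≡⟨ fermat-little {b} (>⇒∤ {{>-nonZero 0<b}} b<p) ⟩
      1 % p                     ∎
      where open ≡-Reasoning
  ... | inj₁ b≡1   = inj₁ b≡1
  ... | inj₂ 1+b≡p = inj₂ (suc-injective 1+b≡p)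

  module QuadraticResidueCoset (x : ℕ) (p∤x : ¬ p ∣ x) (z : ℕ) (z²≈x : z * z ≈ x) where

    H : ℕ → Bool
    H b = inCoset p x 1 b

    ∈H-intro : ∀ k b → x ^ k ≈ b → T (H b)
    ∈H-intro k b xᵏ≈b = inCoset-intro p x 1 b (k % p-1) (<-trans (m%n<n k p-1) (n<1+n p-1))
      (trans (cong (_% p) (*-identityˡ (x ^ (k % p-1)))) (trans (sym (^-reduce-exponent p∤x k)) xᵏ≈b))

    ∈H-elim : ∀ b → T (H b) → ∃ λ k → x ^ k ≈ b
    ∈H-elim b b∈H with k , eq ← inCoset-elim p x 1 b b∈H = k , trans (cong (_% p) (sym (*-identityˡ (x ^ k)))) eq

    1∈H : T (H 1)
    1∈H = ∈H-intro 0 1 refl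

    0∉H : ¬ T (H 0)
    0∉H 0∈H with k , xᵏ≈0 ← ∈H-elim 0 0∈H = p∤x (p∣^⇒p∣ k (m%n≡0⇒n∣m (x ^ k) p xᵏ≈0))

    p-1∉H : ¬ T (H p-1)
    p-1∉H p-1∈H with k , xᵏ≈p-1 ← ∈H-elim p-1 p-1∈H =
      p-1-nonresidue (z ^ k) (trans (cong (_% p) (square-^ z k)) (trans (^-cong {z * z} {x} z²≈x k) xᵏ≈p-1))
      where
      square-^ : ∀ z k → z ^ k * z ^ k ≡ (z * z) ^ k
      square-^ z zero    = refl
      square-^ z (suc k) = trans (interchange z (z ^ k)) (cong (z * z *_) (square-^ z k))
        where
        interchange : ∀ z w → z * w * (z * w) ≡ z * z * (w * w)
        interchange = solve-∀

    inv-preserves-H : ∀ b → T (H b) → T (H (inv b))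
    inv-preserves-H b b∈H with k , xᵏ≈b ← ∈H-elim b b∈H = ∈H-intro (k * (1 + 4 * q)) (inv b) (begin
      x ^ (k * (1 + 4 * q)) % p ≡⟨ cong (_% p) (^-*-assoc x k (1 + 4 * q)) ⟨
      (x ^ k) ^ (1 + 4 * q) % p ≡⟨ ^-cong {x ^ k} {b} xᵏ≈b (1 + 4 * q) ⟩
      b ^ (1 + 4 * q) % p       ≡⟨ %-≈ (b ^ (1 + 4 * q)) ⟨
      inv b % p                 ∎)
      where open ≡-Reasoning

    ∈H⇒0< : ∀ b → T (H b) → 0 < b
    ∈H⇒0< zero    0∈H = ⊥-elim (0∉H 0∈H)
    ∈H⇒0< (suc _) _   = z<s

    π : Fin p → Fin p
    π i = fromℕ< (inv<p (toℕ i))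

    toℕ-π : ∀ i → toℕ (π i) ≡ inv (toℕ i)
    toℕ-π i = Fin.toℕ-fromℕ< (inv<p (toℕ i))

    π-involutive : ∀ i → π (π i) ≡ i
    π-involutive i = Fin.toℕ-injective (begin
      toℕ (π (π i))     ≡⟨ toℕ-π (π i) ⟩
      inv (toℕ (π i))   ≡⟨ cong inv (toℕ-π i) ⟩
      inv (inv (toℕ i)) ≡⟨ inv-involutive (Fin.toℕ<n i) ⟩
      toℕ i             ∎)
      where open ≡-Reasoning

    H∘π≗H : ∀ i → H (toℕ (π i)) ≡ H (toℕ i)
    H∘π≗H i = T-injective
      (λ πi∈H → subst (λ j → T (H (toℕ j))) (π-involutive i)
                      (subst (T ∘ H) (sym (toℕ-π (π i))) (inv-preserves-H (toℕ (π i)) πi∈H)))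
      (λ i∈H → subst (T ∘ H) (sym (toℕ-π i)) (inv-preserves-H (toℕ i) i∈H))

    1ᶠ : Fin p
    1ᶠ = suc zero

    fixed-points : ∀ i → (H (toℕ i) ∧ does (π i Fin.≟ i)) ≡ does (i Fin.≟ 1ᶠ)
    fixed-points i with i Fin.≟ 1ᶠ
    ... | yes refl rewrite Equivalence.to T-≡ 1∈H =
      dec-true (π 1ᶠ Fin.≟ 1ᶠ) (Fin.toℕ-injective (trans (toℕ-π 1ᶠ) (cong (_% p) (^-zeroˡ (1 + 4 * q)))))
    ... | no i≢1 with H (toℕ i) in i∈H
    ...   | false = refl
    ...   | true  = dec-false (π i Fin.≟ i) λ πi≡i →
      [ i≢1 ∘ Fin.toℕ-injective , (λ i≡p-1 → p-1∉H (subst (T ∘ H) i≡p-1 i∈Hᵀ)) ]′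
        (inv-fixed-point (∈H⇒0< (toℕ i) i∈Hᵀ) (Fin.toℕ<n i) (trans (sym (toℕ-π i)) (cong toℕ πi≡i)))
      where
      i∈Hᵀ : T (H (toℕ i))
      i∈Hᵀ = Equivalence.from T-≡ i∈H

    pairs : ℕ
    pairs = count (λ i → H (toℕ i) ∧ does (i Fin.<? π i))

    |H|-odd : count {p} (H ∘ toℕ) ≡ 1 + 2 * pairs
    |H|-odd = count-involution-unique-fixed-point π π-involutive (H ∘ toℕ) H∘π≗H 1ᶠ fixed-points

    p-odd : ∀ b → 2 * b ≢ p
    p-odd b 2b≡p = even≢odd b (1 + 2 * q) (trans 2b≡p (p≡1+2*[1+2q] q))
      where
      p≡1+2*[1+2q] : ∀ q → 3 + 4 * q ≡ 1 + 2 * (1 + 2 * q)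
      p≡1+2*[1+2q] = solve-∀

    ¬balanced : ¬ Balanced x p
    ¬balanced balanced = even≢odd lower pairs (begin
      2 * lower                         ≡⟨ cong (lower +_) (+-identityʳ lower) ⟩
      lower + lower                     ≡⟨ cong (lower +_) (balanced 1 1<p (1-coprimeTo p)) ⟩
      lower + upperCount p x 1          ≡⟨ lowerCount+upperCount p x 1 p-odd 0∉H ⟩
      count {p} (H ∘ toℕ)               ≡⟨ |H|-odd ⟩
      1 + 2 * pairs                     ∎)
      where
      open ≡-Reasoning
      lower : ℕ
      lower = lowerCount p x 1

lemma4p7 : (x y : ℕ) .{{_ : NonZero y}} → Prime x → Prime y → x ≢ 2 → y ≢ 2 → x ≢ y →
           y % 4 ≡ 3 → LegendreOne x y → ¬ Balanced x y
lemma4p7 x 1 _ _ _ _ _ () _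
lemma4p7 x 2 _ _ _ _ _ () _
lemma4p7 x (suc (suc (suc r))) _ y-prime _ _ _ y%4≡3 (y∤x , z , z²≈x)
  with divides q r≡q*4 ← Congruence.≈⇒∣∸ 4 {3} {3 + r} (sym y%4≡3)
  with refl ← trans r≡q*4 (*-comm q 4)
  = ThreeModFour.QuadraticResidueCoset.¬balanced q y-prime x y∤x z z²≈x
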